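{- Let $\delta\geq 6$ be an integer of the form $\delta=4k+2$ with $k$ a positive integer. Then there does not exist a positive odd integer $n$ with the property that there exist positive integers $d_1, d_2$, both dividing $\frac{n^2+1}{2}$, such that $d_1+d_2=\delta n$. -}

module Defs where

{-# OPTIONS --safe #-}
module Submission where

-- Write d₁ = a g and d₂ = b g with g = gcd d₁ d₂. Since lcm d₁ d₂ = a b g divides (n² + 1)/2,
-- we get m a b = n² + 1 with m = 2 r g ≥ 2; as g divides n² + 1 it is coprime to n, so from
-- (a + b) g = δ n we get δ = c g and a + b = c n. For fixed m, c, a the equation
-- n² − m c a n + (m a² + 1) = 0 lets us replace n by (m a² + 1)/n (and then b by c n′ − a),
-- which is smaller as long as n² > m a² + 1. At a solution with n² ≤ m a² + 1 and a ≤ b one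
-- must have a = b, and then m c² n² = 4 n² + 4 forces m c² ≤ 8. But m c² = 2 r c δ ≥ 12.

open import Defs
open import Data.Nat using (ℕ; _+_; _*_; _≥_; _/_)
open import Data.Nat.Divisibility using (_∣_)
open import Data.Product using (∃; ∃-syntax; _×_)
open import Relation.Nullary using (¬_)
open import Relation.Binary.PropositionalEquality using (_≡_)

open import Data.Nat using (zero; suc; _∸_; _≤_; _<_; _≤?_; z≤n; s≤s; z<s; >-nonZero; ≢-nonZero)
open import Data.Nat.Properties
open import Data.Nat.Induction using (<-rec)
open import Data.Nat.Divisibility using (divides; _∣0; ∣-refl; ∣-trans; ∣m∣n⇒∣m+n; ∣m+n∣m⇒∣n; ∣1⇒≡1; n∣m*n; ∣m⇒∣m*n; ∣n⇒∣m*n)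
open import Data.Nat.DivMod using (m/n*n≡m)
open import Data.Nat.GCD using (gcd; gcd[m,n]∣m; gcd[m,n]∣n; gcd[m,n]≢0)
open import Data.Nat.LCM using (lcm; lcm-least; gcd*lcm)
open import Data.Nat.Coprimality using (Coprime; coprime-divisor)
open import Data.List using (_∷_; [])
open import Data.Product using (_,_)
open import Data.Sum using (inj₁; inj₂)
open import Function using (_∘_)
open import Relation.Nullary using (yes; no; contradiction)
open import Relation.Binary.PropositionalEquality using (refl; sym; trans; cong; subst; _≢_; module ≡-Reasoning)
open import Data.Nat.Tactic.RingSolver using (solve)

excess-cofactor : ∀ x y z q → 0 < q → x * y ≡ x * z + q → ∃[ w ] z + w ≡ y × x * w ≡ q
excess-cofactor x y z q 0<q xy≡xz+q = y ∸ z , m+[n∸m]≡n z≤y , x[y∸z]≡q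
  where
  z≤y : z ≤ y
  z≤y = <⇒≤ (*-cancelˡ-< x z y (subst (x * z <_) (sym xy≡xz+q) (m<m+n (x * z) 0<q)))
  x[y∸z]≡q : x * (y ∸ z) ≡ q
  x[y∸z]≡q = begin
    x * (y ∸ z)         ≡⟨ *-distribˡ-∸ x y z ⟩
    x * y ∸ x * z       ≡⟨ cong (_∸ x * z) xy≡xz+q ⟩
    x * z + q ∸ x * z   ≡⟨ m+n∸m≡n (x * z) q ⟩
    q                   ∎
    where open ≡-Reasoning

n-root-identity : ∀ {m c n a b} → a + b ≡ c * n → m * (a * b) ≡ n * n + 1 →
                  n * (m * c * a) ≡ n * n + (m * (a * a) + 1)
n-root-identity {m} {c} {n} {a} {b} sum prod = begin
  n * (m * c * a)            ≡⟨ solve (m ∷ c ∷ n ∷ a ∷ []) ⟩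
  m * a * (c * n)            ≡⟨ cong (m * a *_) sum ⟨
  m * a * (a + b)            ≡⟨ solve (m ∷ a ∷ b ∷ []) ⟩
  m * (a * a) + m * (a * b)  ≡⟨ cong (m * (a * a) +_) prod ⟩
  m * (a * a) + (n * n + 1)  ≡⟨ solve (m ∷ a ∷ n ∷ []) ⟩
  n * n + (m * (a * a) + 1)  ∎
  where open ≡-Reasoning

b-root-identity : ∀ {m c n n′ a} → n + n′ ≡ m * c * a → n * n′ ≡ m * (a * a) + 1 →
                  m * a * (c * n′) ≡ m * a * a + (n′ * n′ + 1)
b-root-identity {m} {c} {n} {n′} {a} sum prod = begin
  m * a * (c * n′)               ≡⟨ solve (m ∷ a ∷ c ∷ n′ ∷ []) ⟩
  n′ * (m * c * a)               ≡⟨ cong (n′ *_) sum ⟨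
  n′ * (n + n′)                  ≡⟨ solve (n′ ∷ n ∷ []) ⟩
  n * n′ + n′ * n′               ≡⟨ cong (_+ n′ * n′) prod ⟩
  m * (a * a) + 1 + n′ * n′      ≡⟨ solve (m ∷ a ∷ n′ ∷ []) ⟩
  m * a * a + (n′ * n′ + 1)      ∎
  where open ≡-Reasoning

vieta-jump : ∀ {m c n a b} → a + b ≡ c * n → m * (a * b) ≡ n * n + 1 → m * (a * a) + 1 < n * n →
             ∃[ n′ ] n′ < n × ∃[ b′ ] a + b′ ≡ c * n′ × m * (a * b′) ≡ n′ * n′ + 1
vieta-jump {m} {c} {n} {a} sum prod ma²+1<n²
  with excess-cofactor n (m * c * a) n _ (m≤n+m 1 _) (n-root-identity {m} {c} {n} {a} sum prod)
... | n′ , n+n′≡mca , nn′≡ma²+1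
  with excess-cofactor (m * a) (c * n′) a _ (m≤n+m 1 _) (b-root-identity {m} {c} {n} n+n′≡mca nn′≡ma²+1)
... | b′ , a+b′≡cn′ , mab′≡n′²+1 =
  n′ , n′<n , b′ , a+b′≡cn′ , trans (sym (*-assoc m a b′)) mab′≡n′²+1
  where
  n′<n : n′ < n
  n′<n = *-cancelˡ-< n n′ n (subst (_< n * n) (sym nn′≡ma²+1) ma²+1<n²)

m*n≡4*n+4⇒m≤8 : ∀ m n → m * n ≡ 4 * n + 4 → m ≤ 8
m*n≡4*n+4⇒m≤8 m zero    mn≡4n+4 = contradiction (trans (sym (*-zeroʳ m)) mn≡4n+4) λ ()
m*n≡4*n+4⇒m≤8 m n@(suc _) mn≡4n+4 = *-cancelʳ-≤ m 8 n (begin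
  m * n          ≡⟨ mn≡4n+4 ⟩
  4 * n + 4      ≤⟨ +-monoʳ-≤ (4 * n) (*-monoʳ-≤ 4 (s≤s z≤n)) ⟩
  4 * n + 4 * n  ≡⟨ *-distribʳ-+ n 4 4 ⟨
  8 * n          ∎)
  where open ≤-Reasoning

diagonal-bound : ∀ {m c n a} → a + a ≡ c * n → m * (a * a) ≡ n * n + 1 → m * (c * c) ≤ 8
diagonal-bound {m} {c} {n} {a} sum prod = m*n≡4*n+4⇒m≤8 (m * (c * c)) (n * n) (begin
  m * (c * c) * (n * n)    ≡⟨ solve (m ∷ c ∷ n ∷ []) ⟩
  m * (c * n * (c * n))    ≡⟨ cong (λ x → m * (x * x)) sum ⟨
  m * ((a + a) * (a + a))  ≡⟨ solve (m ∷ a ∷ []) ⟩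
  4 * (m * (a * a))        ≡⟨ cong (4 *_) prod ⟩
  4 * (n * n + 1)          ≡⟨ solve (n ∷ []) ⟩
  4 * (n * n) + 4          ∎)
  where open ≡-Reasoning

n*n≢3 : ∀ n → n * n ≢ 3
n*n≢3 0 ()
n*n≢3 1 ()
n*n≢3 n@(suc (suc _)) n²≡3 = contradiction (subst (4 ≤_) n²≡3 (*-mono-≤ 2≤n 2≤n)) λ { (s≤s (s≤s (s≤s ()))) }
  where
  2≤n : 2 ≤ n
  2≤n = s≤s (s≤s z≤n)

m*a≤2⇒m≡2×a≡1 : ∀ {m a} → 2 ≤ m → 1 ≤ a → m * a ≤ 2 → m ≡ 2 × a ≡ 1
m*a≤2⇒m≡2×a≡1 {m} {a} 2≤m 1≤a ma≤2 = m≡2 , ≤-antisym a≤1 1≤a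
  where
  instance _ = >-nonZero 1≤a
  m≡2 : m ≡ 2
  m≡2 = ≤-antisym (≤-trans (m≤m*n m a) ma≤2) 2≤m
  a≤1 : a ≤ 1
  a≤1 = *-cancelˡ-≤ 2 (subst (λ k → k * a ≤ 2) m≡2 ma≤2)

below-diagonal⇒m*a≤2 : ∀ {m a b n} → a < b → n * n ≤ m * (a * a) + 1 → m * (a * b) ≡ n * n + 1 → m * a ≤ 2
below-diagonal⇒m*a≤2 {m} {a} {b} {n} a<b n²≤ma²+1 prod = +-cancelˡ-≤ (m * (a * a)) _ _ (begin
  m * (a * a) + m * a  ≡⟨ solve (m ∷ a ∷ []) ⟩
  m * (a * suc a)      ≤⟨ *-monoʳ-≤ m (*-monoʳ-≤ a a<b) ⟩
  m * (a * b)          ≡⟨ prod ⟩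
  n * n + 1            ≤⟨ +-monoˡ-≤ 1 n²≤ma²+1 ⟩
  m * (a * a) + 1 + 1  ≡⟨ +-assoc (m * (a * a)) 1 1 ⟩
  m * (a * a) + 2      ∎)
  where open ≤-Reasoning

no-solution-below-diagonal : ∀ {m a b n} → 2 ≤ m → a < b → n * n ≤ m * (a * a) + 1 → m * (a * b) ≢ n * n + 1
no-solution-below-diagonal {m} {zero} {_} {n} _ _ _ prod = m+1+n≢0 (n * n) (trans (sym prod) (*-zeroʳ m))
no-solution-below-diagonal {m} {a@(suc _)} {b} {n} 2≤m a<b n²≤ma²+1 prod
  with m*a≤2⇒m≡2×a≡1 2≤m (s≤s z≤n) (below-diagonal⇒m*a≤2 {m} {a} {b} {n} a<b n²≤ma²+1 prod)
... | refl , refl = n*n≢3 n (≤-antisym n²≤ma²+1 (+-cancelʳ-≤ 1 3 (n * n) (begin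
  4                    ≤⟨ *-monoʳ-≤ 2 (*-monoʳ-≤ 1 a<b) ⟩
  2 * (1 * b)          ≡⟨ prod ⟩
  n * n + 1            ∎)))
  where open ≤-Reasoning

vieta-solution-bound : ∀ {m} c → 2 ≤ m → ∀ n a b → a + b ≡ c * n → m * (a * b) ≡ n * n + 1 → m * (c * c) ≤ 8
vieta-solution-bound {m} c 2≤m = <-rec Bound descend
  where
  Bound : ℕ → Set
  Bound n = ∀ a b → a + b ≡ c * n → m * (a * b) ≡ n * n + 1 → m * (c * c) ≤ 8

  ordered : ∀ {n a b} → (∀ {n′} → n′ < n → Bound n′) → a ≤ b →
            a + b ≡ c * n → m * (a * b) ≡ n * n + 1 → m * (c * c) ≤ 8
  ordered {n} {a} {b} ih a≤b sum prod with n * n ≤? m * (a * a) + 1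
  ... | no n²≰ma²+1 with vieta-jump {m} {c} {n} {a} sum prod (≰⇒> n²≰ma²+1)
  ...   | n′ , n′<n , b′ , sum′ , prod′ = ih n′<n a b′ sum′ prod′
  ordered {n} {a} {b} ih a≤b sum prod | yes n²≤ma²+1 with m≤n⇒m<n∨m≡n a≤b
  ...   | inj₁ a<b  = contradiction prod (no-solution-below-diagonal {m} {a} {b} {n} 2≤m a<b n²≤ma²+1)
  ...   | inj₂ refl = diagonal-bound {m} {c} {n} {a} sum prod

  descend : ∀ n → (∀ {n′} → n′ < n → Bound n′) → Bound n
  descend n ih a b sum prod with ≤-total a b
  ... | inj₁ a≤b = ordered ih a≤b sum prod
  ... | inj₂ b≤a = ordered ih b≤a (trans (+-comm b a) sum) (trans (cong (m *_) (*-comm b a)) prod)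

¬2∣n⇒n≡1+2*t : ∀ n → ¬ 2 ∣ n → ∃[ t ] n ≡ 1 + 2 * t
¬2∣n⇒n≡1+2*t 0 ¬2∣0 = contradiction (2 ∣0) ¬2∣0
¬2∣n⇒n≡1+2*t 1 _ = 0 , refl
¬2∣n⇒n≡1+2*t (suc (suc n)) ¬2∣2+n with ¬2∣n⇒n≡1+2*t n (¬2∣2+n ∘ ∣m∣n⇒∣m+n ∣-refl)
... | t , refl = suc t , solve (t ∷ [])

¬2∣n⇒2∣n*n+1 : ∀ {n} → ¬ 2 ∣ n → 2 ∣ n * n + 1
¬2∣n⇒2∣n*n+1 {n} ¬2∣n with ¬2∣n⇒n≡1+2*t n ¬2∣n
... | t , refl = divides (2 * (t * t) + 2 * t + 1) (solve (t ∷ []))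

∣n*n+1⇒∣m*n⇒∣m : ∀ {g m n} → g ∣ n * n + 1 → g ∣ m * n → g ∣ m
∣n*n+1⇒∣m*n⇒∣m {g} {m} {n} g∣n²+1 g∣mn = coprime-divisor g⊥n (subst (g ∣_) (*-comm m n) g∣mn)
  where
  g⊥n : Coprime g n
  g⊥n (d∣g , d∣n) = ∣1⇒≡1 (∣m+n∣m⇒∣n (∣-trans d∣g g∣n²+1) (∣n⇒∣m*n n d∣n))

divisors-gcd-split : ∀ {d₁ d₂ q} → 0 < d₁ → d₁ ∣ q → d₂ ∣ q →
                     ∃[ g ] ∃[ a ] ∃[ b ] 0 < g × d₁ ≡ a * g × d₂ ≡ b * g × a * b * g ∣ q
divisors-gcd-split {d₁} {d₂} {q} 0<d₁ d₁∣q d₂∣q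
  with gcd d₁ d₂ | gcd[m,n]∣m d₁ d₂ | gcd[m,n]∣n d₁ d₂ | gcd*lcm d₁ d₂ | gcd[m,n]≢0 d₁ d₂ (inj₁ (n>0⇒n≢0 0<d₁))
... | g | divides a refl | divides b refl | g*l≡d₁d₂ | g≢0 =
  g , a , b , n≢0⇒n>0 g≢0 , refl , refl , subst (_∣ q) l≡abg (lcm-least d₁∣q d₂∣q)
  where
  instance _ = ≢-nonZero g≢0
  l≡abg : lcm (a * g) (b * g) ≡ a * b * g
  l≡abg = *-cancelˡ-≡ _ _ g (trans g*l≡d₁d₂ (solve (a ∷ b ∷ g ∷ [])))

8<2*[r*g]*[c*c] : ∀ {r g c} → 0 < r → 6 ≤ c * g → 8 < 2 * (r * g) * (c * c)
8<2*[r*g]*[c*c] {r} {g} {c} 0<r 6≤cg = begin-strict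
  8                        <⟨ m<m+n 8 z<s ⟩
  2 * 6                    ≤⟨ *-monoʳ-≤ 2 6≤cg ⟩
  2 * (c * g)              ≤⟨ *-monoʳ-≤ 2 (m≤n*m (c * g) (r * c)) ⟩
  2 * (r * c * (c * g))    ≡⟨ solve (r ∷ g ∷ c ∷ []) ⟩
  2 * (r * g) * (c * c)    ∎
  where
  open ≤-Reasoning
  0<c : 0 < c
  0<c = n≢0⇒n>0 λ c≡0 → contradiction (subst (λ x → 6 ≤ x * g) c≡0 6≤cg) λ ()
  instance _ = >-nonZero (*-mono-≤ 0<r 0<c)

divisor-pair⇒vieta-solution : ∀ {δ n q d₁ d₂} → 6 ≤ δ → q * 2 ≡ n * n + 1 → 0 < d₁ → d₁ ∣ q → d₂ ∣ q → d₁ + d₂ ≡ δ * n →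
                 ∃[ m ] ∃[ c ] ∃[ a ] ∃[ b ] 2 ≤ m × 8 < m * (c * c) × a + b ≡ c * n × m * (a * b) ≡ n * n + 1
divisor-pair⇒vieta-solution {δ} {n} 6≤δ q*2≡n²+1 0<d₁ d₁∣q d₂∣q d₁+d₂≡δn
  with divisors-gcd-split 0<d₁ d₁∣q d₂∣q
... | g , a , b , 0<g , refl , refl , divides r refl
  with ∣n*n+1⇒∣m*n⇒∣m {g} {δ} {n}
         (subst (g ∣_) q*2≡n²+1 (∣m⇒∣m*n 2 (∣n⇒∣m*n r (n∣m*n (a * b)))))
         (divides (a + b) (trans (sym d₁+d₂≡δn) (sym (*-distribʳ-+ g a b))))
... | divides c refl =
  2 * (r * g) , c , a , b , *-monoʳ-≤ 2 (*-mono-≤ 0<r 0<g) , 8<2*[r*g]*[c*c] {r} {g} {c} 0<r 6≤δ , a+b≡cn , m[ab]≡n²+1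
  where
  instance _ = >-nonZero 0<g
  0<r : 0 < r
  0<r = n≢0⇒n>0 λ r≡0 → m+1+n≢0 (n * n) (trans (sym q*2≡n²+1) (cong (λ x → x * (a * b * g) * 2) r≡0))
  a+b≡cn : a + b ≡ c * n
  a+b≡cn = *-cancelʳ-≡ _ _ g (begin
    (a + b) * g    ≡⟨ *-distribʳ-+ g a b ⟩
    a * g + b * g  ≡⟨ d₁+d₂≡δn ⟩
    c * g * n      ≡⟨ solve (c ∷ g ∷ n ∷ []) ⟩
    c * n * g      ∎)
    where open ≡-Reasoning
  m[ab]≡n²+1 : 2 * (r * g) * (a * b) ≡ n * n + 1
  m[ab]≡n²+1 = begin
    2 * (r * g) * (a * b)  ≡⟨ solve (r ∷ g ∷ a ∷ b ∷ []) ⟩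
    r * (a * b * g) * 2    ≡⟨ q*2≡n²+1 ⟩
    n * n + 1              ∎
    where open ≡-Reasoning

theorem3 : (δ k : ℕ) → k ≥ 1 → δ ≥ 6 → δ ≡ 4 * k + 2 → ¬ (∃[ n ] (n ≥ 1 × ¬ (2 ∣ n) × ∃[ d₁ ] ∃[ d₂ ] (d₁ ≥ 1 × d₂ ≥ 1 × d₁ ∣ (n * n + 1) / 2 × d₂ ∣ (n * n + 1) / 2 × d₁ + d₂ ≡ δ * n)))
theorem3 δ _ _ δ≥6 _ (n , _ , ¬2∣n , d₁ , d₂ , d₁≥1 , _ , d₁∣q , d₂∣q , d₁+d₂≡δn)
  with divisor-pair⇒vieta-solution δ≥6 (m/n*n≡m (¬2∣n⇒2∣n*n+1 ¬2∣n)) d₁≥1 d₁∣q d₂∣q d₁+d₂≡δn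
... | m , c , a , b , 2≤m , 8<mc² , a+b≡cn , m[ab]≡n²+1 =
  <⇒≱ 8<mc² (vieta-solution-bound c 2≤m n a b a+b≡cn m[ab]≡n²+1)
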